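{- Assume the following set-up. $\Gamma$ is a finite connected graph of valency at most $d$, $G\le\mathrm{Aut}(\Gamma)$ is transitive and quasiprimitive on $V\Gamma$ of type PA: the socle of $G$ is $N=T_1\times\cdots\times T_l\cong T^l$ with $T$ non-abelian simple and $l\ge2$; there is a $G$-invariant partition $\Sigma$ of $V\Gamma$ on which $G$ acts faithfully, and identifying $\Sigma$ with $\Delta^l$ we have $G\le W=H\wr\mathrm{Sym}(l)$ acting on $\Sigma$ in product action, where $H\le\mathrm{Sym}(\Delta)$ is almost simple with socle $T$ and quasiprimitive on $\Delta$, and $N$ is the socle of $W$ ($T_i$ being the $i$-th coordinate factor). Fix $\delta\in\Delta$, let $\sigma=(\delta,\dots,\delta)\in\Sigma$ and fix a vertex $\alpha_0\in\sigma$. For each $i$, let $G_i=N_G(T_i)$ and suppose the permutation group induced by $G_i$ on the $i$-th coordinate $\Delta$ is $H$; let $\pi_i:G_i\to H$ be the corresponding projection. Assume further that $N_{\alpha_0}$ is a subdirect subgroup of $N_\sigma=T_\delta^l$. Then $\pi_i(G_i\cap G_{\alpha_0})=\pi_i(G_i\cap G_\sigma)=H_\delta$ for each $i\in\{1,\dots,l\}$.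
   Context: Here $G_\sigma$ and $N_\sigma$ denote setwise stabilisers of the block $\sigma$; a subgroup of $T_\delta^l$ is subdirect if it projects onto $T_\delta$ in each of the $l$ coordinates. (In the PA set-up, the subdirectness of $N_{\alpha_0}$ in $N_\sigma$ is a known property of quasiprimitive groups of type PA.) -}

module Defs where

open import Level using (0ℓ)
open import Data.Nat using (ℕ; _≤_)
open import Data.Fin using (Fin)
open import Data.Vec using (Vec; lookup; replicate)
open import Data.Product using (Σ; ∃; ∃-syntax; _×_; _,_)
open import Data.Sum using (_⊎_)
open import Relation.Nullary using (¬_)
open import Relation.Binary.PropositionalEquality using (_≡_; _≢_)
open import Relation.Binary.Construct.Closure.ReflexiveTransitive using (Star)
open import Function.Bundles using (_↔_; Inverse)
open import Function.Definitions using (Injective)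
open import Function.Construct.Composition using (_↔-∘_)
open import Function.Construct.Identity using (↔-id)
open import Function.Construct.Symmetry using (↔-sym)

Perm : Set → Set
Perm A = A ↔ A

infixl 7 _·_
infix 4 _≈ₚ_
infixl 9 _⟨$⟩_

_⟨$⟩_ : {A : Set} → Perm A → A → A
g ⟨$⟩ x = Inverse.to g x

-- product: (g · h) x = g (h x)
_·_ : {A : Set} → Perm A → Perm A → Perm A
g · h = g ↔-∘ h

idₚ : {A : Set} → Perm A
idₚ {A} = ↔-id A

inv : {A : Set} → Perm A → Perm A
inv = ↔-sym

_≈ₚ_ : {A : Set} → Perm A → Perm A → Set
g ≈ₚ h = ∀ x → g ⟨$⟩ x ≡ h ⟨$⟩ x

PSet : Set → Set₁
PSet A = Perm A → Set

_⊆_ : {A : Set} → PSet A → PSet A → Set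
K ⊆ L = ∀ g → K g → L g

SameSet : {X : Set} → (X → Set) → (X → Set) → Set
SameSet P Q = (∀ x → P x → Q x) × (∀ x → Q x → P x)

record IsSubgroup {A : Set} (K : PSet A) : Set where
  field
    ∈-resp : ∀ {g h} → g ≈ₚ h → K g → K h
    ∈-id   : K idₚ
    ∈-·    : ∀ {g h} → K g → K h → K (g · h)
    ∈-inv  : ∀ {g} → K g → K (inv g)

TrivialSub : {A : Set} → PSet A → Set
TrivialSub K = ∀ g → K g → g ≈ₚ idₚ

NontrivialSub : {A : Set} → PSet A → Set
NontrivialSub K = ∃[ g ] (K g × ¬ (g ≈ₚ idₚ))

IsNormalSubgroup : {A : Set} → PSet A → PSet A → Set
IsNormalSubgroup K G =
  IsSubgroup K × K ⊆ G × (∀ g x → G g → K x → K (g · x · inv g))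

MinNormal : {A : Set} → PSet A → PSet A → Set₁
MinNormal G M =
  IsNormalSubgroup M G × NontrivialSub M ×
  (∀ (L : PSet _) → IsNormalSubgroup L G → L ⊆ M → TrivialSub L ⊎ M ⊆ L)

data Gen {A : Set} (S : Perm A → Set₁) : Perm A → Set₁ where
  gen  : ∀ {g} → S g → Gen S g
  gid  : Gen S idₚ
  gmul : ∀ {g h} → Gen S g → Gen S h → Gen S (g · h)
  ginv : ∀ {g} → Gen S g → Gen S (inv g)
  gresp : ∀ {g h} → g ≈ₚ h → Gen S g → Gen S h

MinNormalUnion : {A : Set} → PSet A → Perm A → Set₁
MinNormalUnion G g = Σ (PSet _) λ M → MinNormal G M × M g

IsSocle : {A : Set} → PSet A → PSet A → Set₁
IsSocle G N =
  IsSubgroup N ×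
  (∀ g → N g → Gen (MinNormalUnion G) g) ×
  (∀ g → Gen (MinNormalUnion G) g → N g)

IsSimple : {A : Set} → PSet A → Set₁
IsSimple T =
  IsSubgroup T × NontrivialSub T ×
  (∀ (K : PSet _) → IsNormalSubgroup K T → TrivialSub K ⊎ T ⊆ K)

NonAbelian : {A : Set} → PSet A → Set
NonAbelian T = ∃[ x ] ∃[ y ] (T x × T y × ¬ (x · y ≈ₚ y · x))

AlmostSimpleWithSocle : {A : Set} → PSet A → PSet A → Set₁
AlmostSimpleWithSocle H T =
  IsSubgroup H × IsSocle H T × IsSimple T × NonAbelian T

Transitive : {A : Set} → PSet A → Set
Transitive {A} G = ∀ (a b : A) → ∃[ g ] (G g × g ⟨$⟩ a ≡ b)

Quasiprimitive : {A : Set} → PSet A → Set₁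
Quasiprimitive G =
  IsSubgroup G × Transitive G ×
  (∀ (K : PSet _) → IsNormalSubgroup K G → NontrivialSub K → Transitive K)

record Graph (n : ℕ) : Set₁ where
  field
    Adj     : Fin n → Fin n → Set
    symAdj  : ∀ {u v} → Adj u v → Adj v u
    irrefl  : ∀ {u} → ¬ Adj u u
open Graph public

Connected : {n : ℕ} → Graph n → Set
Connected Γ = ∀ u v → Star (Adj Γ) u v

ValencyAtMost : {n : ℕ} → Graph n → ℕ → Set
ValencyAtMost {n} Γ d =
  ∀ (v : Fin n) (k : ℕ) (f : Fin k → Fin n) →
    Injective _≡_ _≡_ f → (∀ j → Adj Γ v (f j)) → k ≤ d

IsAut : {n : ℕ} → Graph n → Perm (Fin n) → Set
IsAut Γ g = ∀ u v → (Adj Γ u v → Adj Γ (g ⟨$⟩ u) (g ⟨$⟩ v))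
                  × (Adj Γ (g ⟨$⟩ u) (g ⟨$⟩ v) → Adj Γ u v)

Wreath : {m : ℕ} (l : ℕ) → PSet (Fin m) → PSet (Vec (Fin m) l)
Wreath {m} l H w =
  Σ (Fin l → Perm (Fin m)) λ hs → (∀ j → H (hs j)) ×
  Σ (Perm (Fin l)) λ π →
    ∀ x j → lookup (w ⟨$⟩ x) j ≡ hs j ⟨$⟩ lookup x (inv π ⟨$⟩ j)

CoordFactor : {m l : ℕ} → PSet (Fin m) → Fin l → PSet (Vec (Fin m) l)
CoordFactor {m} {l} T i w =
  Σ (Perm (Fin m)) λ t → T t ×
    (∀ x → lookup (w ⟨$⟩ x) i ≡ t ⟨$⟩ lookup x i) ×
    (∀ x j → j ≢ i → lookup (w ⟨$⟩ x) j ≡ lookup x j)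

BaseGroup : {m : ℕ} (l : ℕ) → PSet (Fin m) → PSet (Vec (Fin m) l)
BaseGroup {m} l T w =
  Σ (Fin l → Perm (Fin m)) λ ts → (∀ j → T (ts j)) ×
    (∀ x j → lookup (w ⟨$⟩ x) j ≡ ts j ⟨$⟩ lookup x j)

module _ {n m l : ℕ}
         (G : PSet (Fin n))
         (ρ : Perm (Fin n) → Perm (Vec (Fin m) l))
         (T : PSet (Fin m)) where

  ImG : PSet (Vec (Fin m) l)
  ImG w = ∃[ g ] (G g × ρ g ≈ₚ w)

  Gi : Fin l → PSet (Fin n)
  Gi i g = G g × (∀ w → (CoordFactor T i w → CoordFactor T i (ρ g · w · inv (ρ g)))
                      × (CoordFactor T i (ρ g · w · inv (ρ g)) → CoordFactor T i w))

  Proj : Fin l → Perm (Fin n) → Perm (Fin m) → Set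
  Proj i g h = ∀ x → lookup (ρ g ⟨$⟩ x) i ≡ h ⟨$⟩ lookup x i

  ProjImage : Fin l → PSet (Fin n) → PSet (Fin m)
  ProjImage i K h = ∃[ g ] (K g × Proj i g h)

  NV : PSet (Fin n)
  NV g = G g × BaseGroup l T (ρ g)

record PASetup (n m l d : ℕ) (Γ : Graph n) (G : PSet (Fin n))
               (φ : Fin n → Vec (Fin m) l)
               (ρ : Perm (Fin n) → Perm (Vec (Fin m) l))
               (H T : PSet (Fin m)) (δ : Fin m) (α₀ : Fin n) : Set₁ where
  field
    connected   : Connected Γ
    valency     : ValencyAtMost Γ d
    G-subgroup  : IsSubgroup G
    G-aut       : ∀ g → G g → IsAut Γ g
    G-trans     : Transitive G
    G-qp        : Quasiprimitive G
    l≥2         : 2 ≤ l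
    H-as        : AlmostSimpleWithSocle H T
    H-qp        : Quasiprimitive H
    -- G-invariant partition Σ of VΓ, identified with Δ^l via φ (blocks = fibres)
    φ-surj      : ∀ y → ∃[ v ] (φ v ≡ y)
    ρ-induced   : ∀ g → G g → ∀ v → φ (g ⟨$⟩ v) ≡ ρ g ⟨$⟩ φ v
    ρ-faithful  : ∀ g → G g → ρ g ≈ₚ idₚ → g ≈ₚ idₚ
    G≤W         : ∀ g → G g → Wreath l H (ρ g)
    socG        : IsSocle (ImG G ρ T) (BaseGroup l T)
    socW        : IsSocle (Wreath l H) (BaseGroup l T)
    α₀∈σ        : φ α₀ ≡ replicate l δ
    Gi-induces-H : ∀ i → SameSet (ProjImage G ρ T i (Gi G ρ T i)) H
    -- N_{α₀} is subdirect in N_σ = T_δ^l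
    subdirect   : ∀ i t → T t → t ⟨$⟩ δ ≡ δ →
                    ∃[ g ] (NV G ρ T g × g ⟨$⟩ α₀ ≡ α₀ × Proj G ρ T i g t)

module Submission where

-- The three sets are shown to satisfy the cyclic chain of inclusions
--   π_i(G_i ∩ G_α₀) ⊆ π_i(G_i ∩ G_σ) ⊆ H_δ ⊆ π_i(G_i ∩ G_α₀).
-- The first holds because α₀ ∈ σ, the second because π_i(G_i) = H and an element
-- fixing σ fixes its i-th coordinate δ.  The third is the heart of the lemma: given
-- g ∈ G_i with π_i(g) = h ∈ H_δ, the socle N is a nontrivial normal subgroup of the
-- quasiprimitive group G, hence transitive on vertices, so some n ∈ N maps g(α₀) back
-- to α₀; then π_i(ng) = t·h with t ∈ T_δ, and subdirectness of N_α₀ in T_δ^l provides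
-- y ∈ N_α₀ with π_i(y) = t⁻¹, so f = y·n·g lies in G_i ∩ G_α₀ with π_i(f) = h.

open import Defs
open import Data.Nat using (ℕ)
open import Data.Fin using (Fin)
open import Data.Vec using (Vec; replicate; lookup; map)
open import Data.Vec.Properties using (lookup-map; lookup-replicate; map-∘; map-cong; map-id)
open import Data.Product using (_×_; ∃-syntax; _,_; proj₁; proj₂)
open import Relation.Binary.PropositionalEquality
open import Function using (_∘_)
open import Function.Bundles using (Inverse)

module _ {A : Set} where

  cancel-inv : (p : Perm A) → ∀ x → p ⟨$⟩ (inv p ⟨$⟩ x) ≡ x
  cancel-inv = Inverse.strictlyInverseˡ

  inv-cancel : (p : Perm A) → ∀ x → inv p ⟨$⟩ (p ⟨$⟩ x) ≡ x
  inv-cancel = Inverse.strictlyInverseʳ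

  inv-resp : {p q : Perm A} → p ≈ₚ q → inv p ≈ₚ inv q
  inv-resp {p} {q} p≈q x = begin
    inv p ⟨$⟩ x                      ≡⟨ sym (inv-cancel q _) ⟩
    inv q ⟨$⟩ (q ⟨$⟩ (inv p ⟨$⟩ x))  ≡⟨ cong (inv q ⟨$⟩_) (sym (p≈q _)) ⟩
    inv q ⟨$⟩ (p ⟨$⟩ (inv p ⟨$⟩ x))  ≡⟨ cong (inv q ⟨$⟩_) (cancel-inv p x) ⟩
    inv q ⟨$⟩ x                      ∎
    where open ≡-Reasoning

  inv-fixes : (p : Perm A) → ∀ {a} → p ⟨$⟩ a ≡ a → inv p ⟨$⟩ a ≡ a
  inv-fixes p {a} pa≡a = trans (cong (inv p ⟨$⟩_) (sym pa≡a)) (inv-cancel p a)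

socle-⊆ : {A : Set} {K N : PSet A} → IsSubgroup K → IsSocle K N → N ⊆ K
socle-⊆ {K = K} K-subgroup (_ , N⊆gen , _) g Ng = generated⊆K (N⊆gen g Ng)
  where
  open IsSubgroup K-subgroup
  generated⊆K : ∀ {g} → Gen (MinNormalUnion K) g → K g
  generated⊆K (gen (M , ((_ , M⊆K , _) , _) , Mg)) = M⊆K _ Mg
  generated⊆K gid         = ∈-id
  generated⊆K (gmul p q)  = ∈-· (generated⊆K p) (generated⊆K q)
  generated⊆K (ginv p)    = ∈-inv (generated⊆K p)
  generated⊆K (gresp e p) = ∈-resp e (generated⊆K p)

-- The socle of K is closed under conjugation by K, since every minimal normal
-- subgroup is, and conjugation is compatible with the generating operations.
socle-conj : {A : Set} {K N : PSet A} → IsSocle K N →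
             ∀ {a x} → K a → N x → N (a · x · inv a)
socle-conj {K = K} (_ , N⊆gen , gen⊆N) {a} Ka Nx = gen⊆N _ (conj (N⊆gen _ Nx))
  where
  conj : ∀ {x} → Gen (MinNormalUnion K) x → Gen (MinNormalUnion K) (a · x · inv a)
  conj (gen (M , M-minimal , Mx)) =
    gen (M , M-minimal , proj₂ (proj₂ (proj₁ M-minimal)) a _ Ka Mx)
  conj gid         = gresp (λ y → sym (cancel-inv a y)) gid
  conj (gmul {g} {h} p q) =
    gresp (λ y → cong (λ u → a ⟨$⟩ (g ⟨$⟩ u)) (inv-cancel a (h ⟨$⟩ (inv a ⟨$⟩ y))))
          (gmul (conj p) (conj q))
  conj (ginv p)    = gresp (λ _ → refl) (ginv (conj p))
  conj (gresp e p) = gresp (λ y → cong (a ⟨$⟩_) (e _)) (conj p)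

-- A group G acting on X, with a G-invariant partition given by the fibres of the
-- surjection φ : X → Y, where ρ g is the permutation induced by g on the blocks.
module BlockAction {X Y : Set} {G : PSet X} (G-subgroup : IsSubgroup G)
                   {φ : X → Y} (φ-surj : ∀ y → ∃[ v ] (φ v ≡ y))
                   {ρ : Perm X → Perm Y}
                   (ρ-induced : ∀ g → G g → ∀ v → φ (g ⟨$⟩ v) ≡ ρ g ⟨$⟩ φ v) where
  open IsSubgroup G-subgroup

  agree-on-blocks : {p q : Perm Y} → (∀ v → p ⟨$⟩ φ v ≡ q ⟨$⟩ φ v) → p ≈ₚ q
  agree-on-blocks agree y with φ-surj y
  ... | v , refl = agree v

  ρ-resp : ∀ {g h} → G g → G h → g ≈ₚ h → ρ g ≈ₚ ρ h
  ρ-resp {g} {h} Gg Gh g≈h = agree-on-blocks {ρ g} {ρ h} λ v →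
    trans (sym (ρ-induced g Gg v)) (trans (cong φ (g≈h v)) (ρ-induced h Gh v))

  ρ-id : ρ idₚ ≈ₚ idₚ
  ρ-id = agree-on-blocks {ρ idₚ} {idₚ} λ v → sym (ρ-induced idₚ ∈-id v)

  ρ-· : ∀ {g h} → G g → G h → ρ (g · h) ≈ₚ ρ g · ρ h
  ρ-· {g} {h} Gg Gh = agree-on-blocks {ρ (g · h)} {ρ g · ρ h} λ v →
    trans (sym (ρ-induced (g · h) (∈-· Gg Gh) v))
          (trans (ρ-induced g Gg (h ⟨$⟩ v)) (cong (ρ g ⟨$⟩_) (ρ-induced h Gh v)))

  ρ-inv : ∀ {g} → G g → ρ (inv g) ≈ₚ inv (ρ g)
  ρ-inv {g} Gg = agree-on-blocks {ρ (inv g)} {inv (ρ g)} λ v → begin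
    ρ (inv g) ⟨$⟩ φ v                               ≡⟨ sym (ρ-induced (inv g) (∈-inv Gg) v) ⟩
    φ (inv g ⟨$⟩ v)                                 ≡⟨ sym (inv-cancel (ρ g) _) ⟩
    inv (ρ g) ⟨$⟩ (ρ g ⟨$⟩ φ (inv g ⟨$⟩ v))         ≡⟨ cong (inv (ρ g) ⟨$⟩_) (sym (ρ-induced g Gg _)) ⟩
    inv (ρ g) ⟨$⟩ φ (g ⟨$⟩ (inv g ⟨$⟩ v))           ≡⟨ cong (λ u → inv (ρ g) ⟨$⟩ φ u) (cancel-inv g v) ⟩
    inv (ρ g) ⟨$⟩ φ v                               ∎
    where open ≡-Reasoning

  ρ-conj : ∀ {g x} → G g → G x → ρ (g · x · inv g) ≈ₚ ρ g · ρ x · inv (ρ g)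
  ρ-conj {g} {x} Gg Gx y =
    trans (ρ-· (∈-· Gg Gx) (∈-inv Gg) y)
          (trans (ρ-· Gg Gx _) (cong (λ u → ρ g ⟨$⟩ (ρ x ⟨$⟩ u)) (ρ-inv Gg y)))

  Image : PSet Y
  Image w = ∃[ g ] (G g × ρ g ≈ₚ w)

  image-subgroup : IsSubgroup Image
  image-subgroup = record
    { ∈-resp = λ w≈w' (g , Gg , ρg≈w) → g , Gg , λ y → trans (ρg≈w y) (w≈w' y)
    ; ∈-id   = idₚ , ∈-id , ρ-id
    ; ∈-·    = λ { {w} (g , Gg , ρg≈w) (h , Gh , ρh≈w') →
                 g · h , ∈-· Gg Gh , λ y → trans (ρ-· Gg Gh y)
                                             (trans (ρg≈w _) (cong (w ⟨$⟩_) (ρh≈w' y))) }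
    ; ∈-inv  = λ { {w} (g , Gg , ρg≈w) →
                 inv g , ∈-inv Gg , λ y → trans (ρ-inv Gg y) (inv-resp {p = ρ g} {w} ρg≈w y) }
    }

  Preimage : PSet Y → PSet X
  Preimage K g = G g × K (ρ g)

  preimage-normal : {K : PSet Y} → IsSubgroup K →
                    (∀ {a x} → Image a → K x → K (a · x · inv a)) →
                    IsNormalSubgroup (Preimage K) G
  preimage-normal {K} K-subgroup K-conj = subgroup , (λ _ → proj₁) , conj
    where
    module K = IsSubgroup K-subgroup
    subgroup : IsSubgroup (Preimage K)
    subgroup = record
      { ∈-resp = λ g≈h (Gg , Kg) → let Gh = ∈-resp g≈h Gg in
                   Gh , K.∈-resp (ρ-resp Gg Gh g≈h) Kg
      ; ∈-id   = ∈-id , K.∈-resp (λ y → sym (ρ-id y)) K.∈-id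
      ; ∈-·    = λ (Gg , Kg) (Gh , Kh) →
                   ∈-· Gg Gh , K.∈-resp (λ y → sym (ρ-· Gg Gh y)) (K.∈-· Kg Kh)
      ; ∈-inv  = λ (Gg , Kg) → ∈-inv Gg , K.∈-resp (λ y → sym (ρ-inv Gg y)) (K.∈-inv Kg)
      }
    conj : ∀ g x → G g → Preimage K x → Preimage K (g · x · inv g)
    conj g x Gg (Gx , Kx) =
      ∈-· (∈-· Gg Gx) (∈-inv Gg) ,
      K.∈-resp (λ y → sym (ρ-conj {g} {x} Gg Gx y)) (K-conj {ρ g} {ρ x} (g , Gg , λ _ → refl) Kx)

  preimage-nontrivial : {K : PSet Y} → IsSubgroup K → K ⊆ Image → NontrivialSub K →
                        NontrivialSub (Preimage K)
  preimage-nontrivial K-subgroup K⊆Image (k , Kk , k≉id) with K⊆Image k Kk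
  ... | g , Gg , ρg≈k =
    g , (Gg , IsSubgroup.∈-resp K-subgroup (λ y → sym (ρg≈k y)) Kk) ,
    λ g≈id → k≉id λ y →
      trans (sym (ρg≈k y)) (trans (ρ-resp Gg ∈-id g≈id y) (ρ-id y))

module ProductAction {m l : ℕ} {T : PSet (Fin m)} where

  Coordinatewise : (Fin l → Perm (Fin m)) → Perm (Vec (Fin m) l) → Set
  Coordinatewise ts p = ∀ x j → lookup (p ⟨$⟩ x) j ≡ ts j ⟨$⟩ lookup x j

  inv-coordinatewise : ∀ {ts p} → Coordinatewise ts p →
                       Coordinatewise (λ j → inv (ts j)) (inv p)
  inv-coordinatewise {ts} {p} p-coords x j = begin
    lookup (inv p ⟨$⟩ x) j                                ≡⟨ sym (inv-cancel (ts j) _) ⟩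
    inv (ts j) ⟨$⟩ (ts j ⟨$⟩ lookup (inv p ⟨$⟩ x) j)      ≡⟨ cong (inv (ts j) ⟨$⟩_) (sym (p-coords _ j)) ⟩
    inv (ts j) ⟨$⟩ lookup (p ⟨$⟩ (inv p ⟨$⟩ x)) j         ≡⟨ cong (λ v → inv (ts j) ⟨$⟩ lookup v j) (cancel-inv p x) ⟩
    inv (ts j) ⟨$⟩ lookup x j                             ∎
    where open ≡-Reasoning

  coordFactor-resp : ∀ {i : Fin l} {w w'} → w ≈ₚ w' → CoordFactor T i w → CoordFactor T i w'
  coordFactor-resp {i} w≈w' (t , Tt , on-i , off-i) =
    t , Tt , (λ x → trans (cong (λ v → lookup v i) (sym (w≈w' x))) (on-i x)) ,
    λ x j j≢i → trans (cong (λ v → lookup v j) (sym (w≈w' x))) (off-i x j j≢i)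

  Normalises : Fin l → Perm (Vec (Fin m) l) → Set
  Normalises i p = ∀ w → (CoordFactor T i w → CoordFactor T i (p · w · inv p))
                       × (CoordFactor T i (p · w · inv p) → CoordFactor T i w)

  normalises-resp : ∀ {i p q} → p ≈ₚ q → Normalises i p → Normalises i q
  normalises-resp {i} {p} {q} p≈q p-norm w =
    (λ cf → coordFactor-resp {i} {p · w · inv p} {q · w · inv q} conj≈ (proj₁ (p-norm w) cf)) ,
    (λ cf → proj₂ (p-norm w) (coordFactor-resp {i} {q · w · inv q} {p · w · inv p} (λ x → sym (conj≈ x)) cf))
    where
    conj≈ : p · w · inv p ≈ₚ q · w · inv q
    conj≈ x = trans (p≈q _) (cong (λ u → q ⟨$⟩ (w ⟨$⟩ u)) (inv-resp {p = p} {q} p≈q x))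

  normalises-· : ∀ {i p q} → Normalises i p → Normalises i q → Normalises i (p · q)
  normalises-· {i} {p} {q} p-norm q-norm w =
    (λ cf → proj₁ (p-norm (q · w · inv q)) (proj₁ (q-norm w) cf)) ,
    (λ cf → proj₂ (q-norm w) (proj₂ (p-norm (q · w · inv q)) cf))

  -- Elements of T^l normalise each T_i: conjugating (…, t, …) by (ts_j)_j gives
  -- (…, ts_i t ts_i⁻¹, …).
  base-normalises : IsSubgroup T → ∀ {i w} → BaseGroup l T w → Normalises i w
  base-normalises T-subgroup {i} {p} (ts , Tts , p-coords) w = conjugate , unconjugate
    where
    open IsSubgroup T-subgroup
    p⁻¹-coords = inv-coordinatewise {ts} {p} p-coords
    conjugate : CoordFactor T i w → CoordFactor T i (p · w · inv p)
    conjugate (t , Tt , on-i , off-i) =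
      ts i · t · inv (ts i) , ∈-· (∈-· (Tts i) Tt) (∈-inv (Tts i)) ,
      (λ x → trans (p-coords _ i)
               (cong (ts i ⟨$⟩_) (trans (on-i _) (cong (t ⟨$⟩_) (p⁻¹-coords x i))))) ,
      λ x j j≢i → trans (p-coords _ j)
                    (trans (cong (ts j ⟨$⟩_) (trans (off-i _ j j≢i) (p⁻¹-coords x j)))
                           (cancel-inv (ts j) _))
    w≡ : ∀ x → w ⟨$⟩ x ≡ inv p ⟨$⟩ ((p · w · inv p) ⟨$⟩ (p ⟨$⟩ x))
    w≡ x = trans (sym (inv-cancel p (w ⟨$⟩ x)))
                 (cong (λ y → inv p ⟨$⟩ (p ⟨$⟩ (w ⟨$⟩ y))) (sym (inv-cancel p x)))
    unconjugate : CoordFactor T i (p · w · inv p) → CoordFactor T i w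
    unconjugate (t , Tt , on-i , off-i) =
      inv (ts i) · t · ts i , ∈-· (∈-· (∈-inv (Tts i)) Tt) (Tts i) ,
      (λ x → trans (cong (λ v → lookup v i) (w≡ x))
               (trans (p⁻¹-coords _ i)
                 (cong (inv (ts i) ⟨$⟩_) (trans (on-i _) (cong (t ⟨$⟩_) (p-coords x i)))))) ,
      λ x j j≢i → trans (cong (λ v → lookup v j) (w≡ x))
                    (trans (p⁻¹-coords _ j)
                      (trans (cong (inv (ts j) ⟨$⟩_) (trans (off-i _ j j≢i) (p-coords x j)))
                             (inv-cancel (ts j) _)))

  diagonal : Perm (Fin m) → Perm (Vec (Fin m) l)
  diagonal t = record
    { to        = map (t ⟨$⟩_)
    ; from      = map (inv t ⟨$⟩_)
    ; to-cong   = cong _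
    ; from-cong = cong _
    ; inverse   = (λ { refl → cancels (cancel-inv t) _ }) , (λ { refl → cancels (inv-cancel t) _ })
    }
    where
    cancels : ∀ {f g : Fin m → Fin m} → (∀ a → f (g a) ≡ a) → ∀ xs → map f (map g xs) ≡ xs
    cancels {f} {g} fg≡id xs =
      trans (sym (map-∘ f g xs)) (trans (map-cong fg≡id xs) (map-id xs))

  base-nontrivial : Fin l → NontrivialSub T → NontrivialSub (BaseGroup l T)
  base-nontrivial j (t , Tt , t≉id) =
    diagonal t , ((λ _ → t) , (λ _ → Tt) , λ x k → lookup-map k (t ⟨$⟩_) x) ,
    λ diag≈id → t≉id λ a → begin
      t ⟨$⟩ a                                ≡⟨ cong (t ⟨$⟩_) (sym (lookup-replicate j a)) ⟩
      t ⟨$⟩ lookup (replicate l a) j         ≡⟨ sym (lookup-map j (t ⟨$⟩_) (replicate l a)) ⟩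
      lookup (diagonal t ⟨$⟩ replicate l a) j ≡⟨ cong (λ v → lookup v j) (diag≈id (replicate l a)) ⟩
      lookup (replicate l a) j               ≡⟨ lookup-replicate j a ⟩
      a                                      ∎
    where open ≡-Reasoning

module PASetting {n m l d : ℕ} {Γ : Graph n} {G : PSet (Fin n)}
                 {φ : Fin n → Vec (Fin m) l}
                 {ρ : Perm (Fin n) → Perm (Vec (Fin m) l)}
                 {H T : PSet (Fin m)} {δ : Fin m} {α₀ : Fin n}
                 (S : PASetup n m l d Γ G φ ρ H T δ α₀) (i : Fin l) where
  open PASetup S
  open IsSubgroup G-subgroup
  open BlockAction G-subgroup φ-surj {ρ} ρ-induced
  open ProductAction {m} {l} {T}

  T-simple : IsSimple T
  T-simple = proj₁ (proj₂ (proj₂ H-as))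

  σ : Vec (Fin m) l
  σ = replicate l δ

  N-normal : IsNormalSubgroup (NV G ρ T) G
  N-normal = preimage-normal (proj₁ socG) (λ {a} {x} → socle-conj socG {a} {x})

  -- N is nontrivial, so quasiprimitivity of G makes it transitive on vertices.
  N-transitive : Transitive (NV G ρ T)
  N-transitive = proj₂ (proj₂ G-qp) (NV G ρ T) N-normal
    (preimage-nontrivial (proj₁ socG) (socle-⊆ image-subgroup socG)
                         (base-nontrivial i (proj₁ (proj₂ T-simple))))

  N⊆Gᵢ : NV G ρ T ⊆ Gi G ρ T i
  N⊆Gᵢ g (Gg , Ng) = Gg , base-normalises (proj₁ T-simple) {i} {ρ g} Ng

  Gᵢ-· : ∀ {g h} → Gi G ρ T i g → Gi G ρ T i h → Gi G ρ T i (g · h)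
  Gᵢ-· {g} {h} (Gg , g-norm) (Gh , h-norm) =
    ∈-· Gg Gh ,
    normalises-resp {i} {ρ g · ρ h} {ρ (g · h)} (λ y → sym (ρ-· Gg Gh y))
                    (normalises-· {i} {ρ g} {ρ h} g-norm h-norm)

  proj-· : ∀ {g g' s t} → G g → G g' → Proj G ρ T i g s → Proj G ρ T i g' t →
           Proj G ρ T i (g · g') (s · t)
  proj-· {s = s} Gg Gg' πg πg' x =
    trans (cong (λ v → lookup v i) (ρ-· Gg Gg' x)) (trans (πg _) (cong (s ⟨$⟩_) (πg' x)))

  proj-resp : ∀ {g s t} → s ≈ₚ t → Proj G ρ T i g s → Proj G ρ T i g t
  proj-resp s≈t πg x = trans (πg x) (s≈t _)

  proj-fixes-δ : ∀ {g s} → Proj G ρ T i g s → ρ g ⟨$⟩ σ ≡ σ → s ⟨$⟩ δ ≡ δ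
  proj-fixes-δ {g} {s} πg gσ≡σ = begin
    s ⟨$⟩ δ                 ≡⟨ cong (s ⟨$⟩_) (sym (lookup-replicate i δ)) ⟩
    s ⟨$⟩ lookup σ i        ≡⟨ sym (πg σ) ⟩
    lookup (ρ g ⟨$⟩ σ) i    ≡⟨ cong (λ v → lookup v i) gσ≡σ ⟩
    lookup σ i              ≡⟨ lookup-replicate i δ ⟩
    δ                       ∎
    where open ≡-Reasoning

  stab-α₀⊆stab-σ : ∀ {g} → G g → g ⟨$⟩ α₀ ≡ α₀ → ρ g ⟨$⟩ σ ≡ σ
  stab-α₀⊆stab-σ {g} Gg gα₀≡α₀ = begin
    ρ g ⟨$⟩ σ        ≡⟨ cong (ρ g ⟨$⟩_) (sym α₀∈σ) ⟩
    ρ g ⟨$⟩ φ α₀     ≡⟨ sym (ρ-induced g Gg α₀) ⟩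
    φ (g ⟨$⟩ α₀)     ≡⟨ cong φ gα₀≡α₀ ⟩
    φ α₀             ≡⟨ α₀∈σ ⟩
    σ                ∎
    where open ≡-Reasoning

  -- First correction: some n ∈ N maps g(α₀) back to α₀; then ng ∈ G_i fixes α₀ and
  -- π_i(ng) = t·h where t = π_i(n) ∈ T fixes δ.
  correct-by-N : ∀ {g h} → Gi G ρ T i g → Proj G ρ T i g h → h ⟨$⟩ δ ≡ δ →
                 ∃[ k ] ∃[ t ] ((Gi G ρ T i k × k ⟨$⟩ α₀ ≡ α₀) ×
                                (T t × t ⟨$⟩ δ ≡ δ) × Proj G ρ T i k (t · h))
  correct-by-N {g} {h} Gᵢg πg hδ≡δ with N-transitive (g ⟨$⟩ α₀) α₀
  ... | n , Nn@(Gn , ts , Tts , n-coords) , ngα₀≡α₀ =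
    n · g , ts i , (Gᵢ-· (N⊆Gᵢ n Nn) Gᵢg , ngα₀≡α₀) , (Tts i , tδ≡δ) , πng
    where
    Gng = ∈-· Gn (proj₁ Gᵢg)
    πng : Proj G ρ T i (n · g) (ts i · h)
    πng = proj-· {s = ts i} {h} Gn (proj₁ Gᵢg) (λ x → n-coords x i) πg
    tδ≡δ : ts i ⟨$⟩ δ ≡ δ
    tδ≡δ = trans (cong (ts i ⟨$⟩_) (sym hδ≡δ))
                 (proj-fixes-δ {n · g} {ts i · h} πng (stab-α₀⊆stab-σ Gng ngα₀≡α₀))

  -- Second correction: subdirectness of N_α₀ in T_δ^l gives y ∈ N_α₀ with
  -- π_i(y) = t⁻¹, so y·k ∈ G_i ∩ G_α₀ and π_i(y·k) = h.
  correct-by-subdirect : ∀ {k t h} → Gi G ρ T i k → k ⟨$⟩ α₀ ≡ α₀ → T t → t ⟨$⟩ δ ≡ δ →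
                         Proj G ρ T i k (t · h) →
                         ∃[ f ] ((Gi G ρ T i f × f ⟨$⟩ α₀ ≡ α₀) × Proj G ρ T i f h)
  correct-by-subdirect {k} {t} {h} Gᵢk kα₀≡α₀ Tt tδ≡δ πk
    with subdirect i (inv t) (IsSubgroup.∈-inv (proj₁ T-simple) Tt) (inv-fixes t tδ≡δ)
  ... | y , Ny , yα₀≡α₀ , πy =
    y · k ,
    (Gᵢ-· (N⊆Gᵢ y Ny) Gᵢk , trans (cong (y ⟨$⟩_) kα₀≡α₀) yα₀≡α₀) ,
    proj-resp {y · k} {inv t · (t · h)} {h} (λ a → inv-cancel t (h ⟨$⟩ a))
              (proj-· {s = inv t} {t · h} (proj₁ Ny) (proj₁ Gᵢk) πy πk)

  lift : ∀ {g h} → Gi G ρ T i g → Proj G ρ T i g h → h ⟨$⟩ δ ≡ δ →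
         ∃[ f ] ((Gi G ρ T i f × f ⟨$⟩ α₀ ≡ α₀) × Proj G ρ T i f h)
  lift {g} {h} Gᵢg πg hδ≡δ with correct-by-N {g} {h} Gᵢg πg hδ≡δ
  ... | _ , _ , (Gᵢk , kα₀≡α₀) , (Tt , tδ≡δ) , πk =
    correct-by-subdirect {h = h} Gᵢk kα₀≡α₀ Tt tδ≡δ πk

  G-α₀ G-σ : PSet (Fin n)
  G-α₀ g = Gi G ρ T i g × g ⟨$⟩ α₀ ≡ α₀
  G-σ g = Gi G ρ T i g × ρ g ⟨$⟩ σ ≡ σ

  H-δ : PSet (Fin m)
  H-δ h = H h × h ⟨$⟩ δ ≡ δ

  πα₀⊆πσ : ProjImage G ρ T i G-α₀ ⊆ ProjImage G ρ T i G-σ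
  πα₀⊆πσ h (g , (Gᵢg , gα₀≡α₀) , πg) = g , (Gᵢg , stab-α₀⊆stab-σ (proj₁ Gᵢg) gα₀≡α₀) , πg

  πσ⊆Hδ : ProjImage G ρ T i G-σ ⊆ H-δ
  πσ⊆Hδ h (g , (Gᵢg , gσ≡σ) , πg) =
    proj₁ (Gi-induces-H i) h (g , Gᵢg , πg) , proj-fixes-δ {g} {h} πg gσ≡σ

  Hδ⊆πα₀ : H-δ ⊆ ProjImage G ρ T i G-α₀
  Hδ⊆πα₀ h (Hh , hδ≡δ) with proj₂ (Gi-induces-H i) h Hh
  ... | g , Gᵢg , πg = lift {g} {h} Gᵢg πg hδ≡δ

lemma4p7 : ∀ {n m l d : ℕ} {Γ : Graph n} {G : PSet (Fin n)}
    {φ : Fin n → Vec (Fin m) l}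
    {ρ : Perm (Fin n) → Perm (Vec (Fin m) l)}
    {H T : PSet (Fin m)} {δ : Fin m} {α₀ : Fin n} →
    PASetup n m l d Γ G φ ρ H T δ α₀ →
    ∀ (i : Fin l) →
    SameSet (ProjImage G ρ T i (λ g → Gi G ρ T i g × g ⟨$⟩ α₀ ≡ α₀))
    (ProjImage G ρ T i (λ g → Gi G ρ T i g × ρ g ⟨$⟩ replicate l δ ≡ replicate l δ))
    × SameSet (ProjImage G ρ T i (λ g → Gi G ρ T i g × ρ g ⟨$⟩ replicate l δ ≡ replicate l δ))
    (λ h → H h × h ⟨$⟩ δ ≡ δ)
lemma4p7 S i =
  (πα₀⊆πσ , λ h → Hδ⊆πα₀ h ∘ πσ⊆Hδ h) ,
  (πσ⊆Hδ  , λ h → πα₀⊆πσ h ∘ Hδ⊆πα₀ h)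
  where open PASetting S i
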